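{- Let $\pi \in S_n$ and let $f=(\tau_1,\ldots,\tau_r)$ be a minimal transitive star factorization of $\pi$. Let $\sigma$ be a cycle of $\pi$. (1) If $\sigma=(a_1\,a_2\,\ldots\,a_\ell)$ with $a_i \neq 1$ for all $i$, then some transposition $(1\,a_j)$ appears exactly twice in $f$, while every transposition $(1\,a_i)$ with $i\neq j$ appears exactly once in $f$. (2) If $\sigma=(1\,b_2\,\cdots\,b_\ell)$, then each transposition $(1\,b_i)$ appears exactly once in $f$. Moreover, in case (1), if (writing the cycle so that) $(1\,a_1)$ is the transposition appearing twice, then the factors of $f$ meeting $\sigma$, read from right to left, are $(1\,a_1),(1\,a_2),\ldots,(1\,a_\ell),(1\,a_1)$. In case (2), the factors of $f$ meeting $\sigma$, read from right to left, are $(1\,b_2),(1\,b_3),\ldots,(1\,b_\ell)$.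
   Context: A star transposition in $S_n$ is a transposition $(1\,i)$ with $2\le i\le n$. Permutations are multiplied as functions, $\rho\sigma(j)=\rho(\sigma(j))$. A star factorization of $\pi\in S_n$ of length $r$ is an ordered list $(\tau_1,\ldots,\tau_r)$ of star transpositions with $\tau_1\cdots\tau_r=\pi$; it is transitive if the group generated by its factors acts transitively on $\{1,\ldots,n\}$. If $\pi$ has $m$ cycles (counting fixed points), a minimal transitive star factorization of $\pi$ is a transitive star factorization of length $n+m-2$ (the least possible length of a transitive one). A star transposition $(1\,i)$ meets the cycle $\sigma$ of $\pi$ if $\sigma$ contains the symbol $i$. "Read from right to left" means listed in order of decreasing position index in $f$. -}

module Defs where

open import Data.Nat using (ℕ; zero; suc; _+_; _∸_; _≤_)
open import Data.Fin using (Fin; zero; suc; toℕ; _≟_)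
open import Data.Fin.Properties using (all?)
open import Data.Fin.Permutation using (Permutation′; _⟨$⟩ʳ_)
open import Data.List using (List; []; _∷_; length; filter; allFin; reverse)
open import Data.List.Relation.Unary.Any using (any?)
open import Data.List.Relation.Unary.All using (All)
open import Data.List.Relation.Unary.Unique.Propositional using (Unique)
open import Data.List.Membership.Propositional using (_∈_)
open import Data.Product using (_×_; ∃)
open import Data.Empty using (⊥)
open import Data.Bool using (if_then_else_)
open import Relation.Nullary using (does; ¬_)
open import Relation.Binary.PropositionalEquality using (_≡_; _≢_)
import Data.Nat.Properties as ℕP

-- Symbols of S_N with N = suc n are Fin (suc n); the symbol "1" is `zero`.

-- The star transposition (1 i) as a function (intended for i ≢ zero).
star : ∀ {n} → Fin (suc n) → Fin (suc n) → Fin (suc n)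
star i j = if does (j ≟ zero) then i else (if does (j ≟ i) then zero else j)

-- A list of star transpositions is represented by the list of their
-- non-1 symbols: (τ₁,…,τᵣ) = ((1 i₁),…,(1 iᵣ)) is  i₁ ∷ … ∷ iᵣ ∷ [].
prod : ∀ {n} → List (Fin (suc n)) → Fin (suc n) → Fin (suc n)
prod []       j = j
prod (i ∷ is) j = star i (prod is j)

AllStar : ∀ {n} → List (Fin (suc n)) → Set
AllStar f = All (λ i → i ≢ zero) f

IsStarFactorization : ∀ {n} → Permutation′ (suc n) → List (Fin (suc n)) → Set
IsStarFactorization π f = AllStar f × (∀ j → prod f j ≡ π ⟨$⟩ʳ j)

-- The group generated by the factors acts transitively: any x can be sent
-- to any y by a word in the generators (inverses are unnecessary since the
-- generators are involutions).
Transitive : ∀ {n} → List (Fin (suc n)) → Set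
Transitive {n} f = ∀ (x y : Fin (suc n)) →
  ∃ λ (w : List (Fin (suc n))) → All (λ i → i ∈ f) w × prod w x ≡ y

iter : ∀ {N} → Permutation′ N → ℕ → Fin N → Fin N
iter π zero    x = x
iter π (suc k) x = π ⟨$⟩ʳ (iter π k x)

-- x is the least symbol of its cycle (cycles have length ≤ N).
CycleLeader : ∀ {N} → Permutation′ N → Fin N → Set
CycleLeader {N} π x = ∀ (k : Fin N) → toℕ x ≤ toℕ (iter π (toℕ k) x)

-- Number of cycles of π (fixed points included) = number of cycle leaders.
numCycles : ∀ {N} → Permutation′ N → ℕ
numCycles {N} π =
  length (filter {P = CycleLeader π} (λ x → all? (λ k → toℕ x ℕP.≤? toℕ (iter π (toℕ k) x))) (allFin N))

IsMinTransStarFact : ∀ {n} → Permutation′ (suc n) → List (Fin (suc n)) → Set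
IsMinTransStarFact {n} π f =
  IsStarFactorization π f × Transitive f × length f ≡ (suc n + numCycles π) ∸ 2

Closes : ∀ {N} → Permutation′ N → Fin N → List (Fin N) → Set
Closes π a₁ []           = ⊥
Closes π a₁ (x ∷ [])     = π ⟨$⟩ʳ x ≡ a₁
Closes π a₁ (x ∷ y ∷ xs) = (π ⟨$⟩ʳ x ≡ y) × Closes π a₁ (y ∷ xs)

IsCycle : ∀ {N} → Permutation′ N → List (Fin N) → Set
IsCycle π []       = ⊥
IsCycle π (a ∷ as) = Unique (a ∷ as) × Closes π a (a ∷ as)

occ : ∀ {n} → List (Fin (suc n)) → Fin (suc n) → ℕ
occ f i = length (filter (λ t → t ≟ i) f)

-- The factors of f meeting the cycle σ, read from right to left
-- (i.e. in order of decreasing position in f).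
meeting : ∀ {n} → List (Fin (suc n)) → List (Fin (suc n)) → List (Fin (suc n))
meeting f σ = filter {P = λ t → t ∈ σ} (λ t → any? (λ s → t ≟ s) σ) (reverse f)

{-# OPTIONS --safe #-}
-- Read f from right to left, in the order in which its factors act. A symbol x ≠ 1 is fixed
-- until the first factor (1 x), which sends it to 1, and only a later factor (1 y) takes 1 on
-- to y. Hence for every step x ↦ π x between symbols ≠ 1, some (1 x) is followed later by a
-- (1 π x). Applied to the predecessor of the first symbol met in a cycle avoiding 1, this shows
-- that this first symbol occurs at least twice. Transitivity makes every symbol ≠ 1 occur, so
-- the length n + m − 2 leaves exactly m − 1 surplus occurrences, one for each cycle avoiding 1:
-- the first-met symbols are the only repeated ones and they occur exactly twice. The order of
-- the factors meeting a cycle is then forced by the steps x ↦ π x.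
module Submission where

open import Defs
open import Data.Empty using (⊥-elim)
open import Data.Fin using (Fin; zero; suc; toℕ; fromℕ<; _≟_)
import Data.Fin.Properties as Fin
open import Data.Fin.Permutation using (Permutation′; _⟨$⟩ʳ_; _⟨$⟩ˡ_; inverseˡ)
open import Data.List
  using (List; []; _∷_; _∷ʳ_; _++_; length; map; filter; reverse; iterate; take; drop; lookup;
         tabulate; allFin; head)
import Data.List.Properties as List
open import Data.List.Membership.Propositional using (_∈_; _∉_; find; lose)
open import Data.List.Membership.Propositional.Properties
  using (∈-filter⁺; ∈-filter⁻; ∈-map⁺; ∈-map⁻; ∈-tabulate⁺; ∈-tabulate⁻; ∈-allFin; ∈-lookup)
open import Data.List.Relation.Binary.Permutation.Propositional
  using (_↭_; ↭-sym; ↭-trans; ↭-reflexive; ↭-prep; ↭⇒↭ₛ; module PermutationReasoning)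
open import Data.List.Relation.Binary.Permutation.Propositional.Properties
  using (filter-↭; ↭-length; drop-∷; ∷↭∷ʳ; ↭-reverse; ∈-resp-↭; ++-comm)
import Data.List.Relation.Binary.Permutation.Setoid.Properties as PermutationSetoid
open import Data.List.Relation.Binary.Sublist.Propositional as Sublist using (_⊆_; _∷_; to∈; from∈)
open import Data.List.Relation.Binary.Sublist.Propositional.Properties using (∷ʳ⁻; ∷⁻; filter⁺)
open import Data.List.Relation.Unary.All as All using (All; []; _∷_)
open import Data.List.Relation.Unary.All.Properties using (All¬⇒¬Any)
open import Data.List.Relation.Unary.AllPairs as AllPairs using ([]; _∷_)
open import Data.List.Relation.Unary.Any as Any using (Any; here; there)
open import Data.List.Relation.Unary.Any.Properties using (lookup-index)
open import Data.List.Relation.Unary.Unique.Propositional using (Unique)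
import Data.List.Relation.Unary.Unique.Propositional.Properties as Unique
open import Data.Maybe using (fromMaybe)
open import Data.Nat using (ℕ; zero; suc; _+_; _∸_; _≤_; _<_; z≤n; s≤s; _≤?_)
open import Data.Nat.ListAction using (sum)
import Data.Nat.Properties as ℕ
open import Algebra.Properties.CommutativeSemigroup ℕ.+-commutativeSemigroup
  using (interchange; x∙yz≈y∙xz)
open import Data.Product using (_×_; _,_; proj₁; proj₂; ∃; ∃₂)
open import Function using (_∘′_)
open import Level using (0ℓ)
open import Relation.Binary.Definitions using (DecidableEquality)
open import Relation.Binary.PropositionalEquality
  using (_≡_; _≢_; refl; sym; trans; cong; cong₂; subst; module ≡-Reasoning)
open import Relation.Binary.PropositionalEquality.Properties using (setoid)
open import Relation.Nullary using (¬_; Dec; yes; no; ¬?; map′)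
open import Relation.Unary using (Pred; Decidable)

module _ {A : Set} where

  ∈∧∉⇒≢ : ∀ {x y : A} {xs} → x ∈ xs → y ∉ xs → x ≢ y
  ∈∧∉⇒≢ x∈ y∉ refl = y∉ x∈

  drop++take↭ : ∀ k (xs : List A) → drop k xs ++ take k xs ↭ xs
  drop++take↭ k xs = ↭-trans (++-comm (drop k xs) (take k xs)) (↭-reflexive (List.take++drop≡id k xs))

  Unique-resp-↭ : ∀ {xs ys : List A} → xs ↭ ys → Unique xs → Unique ys
  Unique-resp-↭ xs↭ys = PermutationSetoid.Unique-resp-↭ (setoid A) (↭⇒↭ₛ xs↭ys)

  Unique-lookup-injective : ∀ {xs : List A} → Unique xs → ∀ i j → lookup xs i ≡ lookup xs j → i ≡ j
  Unique-lookup-injective {x ∷ xs} _        zero    zero    _ = refl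
  Unique-lookup-injective {x ∷ xs} (x∉ ∷ _) zero    (suc j) e = ⊥-elim (All.lookup x∉ (∈-lookup j) e)
  Unique-lookup-injective {x ∷ xs} (x∉ ∷ _) (suc i) zero    e = ⊥-elim (All.lookup x∉ (∈-lookup i) (sym e))
  Unique-lookup-injective {x ∷ xs} (_ ∷ u)  (suc i) (suc j) e = cong suc (Unique-lookup-injective u i j e)

  module _ {P : Pred A 0ℓ} (P? : Decidable P) where

    filter-∷ : ∀ {x xs} → x ∈ xs → P x → ∃₂ λ c t → filter P? xs ≡ c ∷ t × P c
    filter-∷ {xs = y ∷ ys} x∈ px with P? y
    ... | yes py = y , filter P? ys , refl , py
    ... | no ¬py with x∈
    ...   | here refl  = ⊥-elim (¬py px)
    ...   | there x∈ys = filter-∷ x∈ys px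

    fromMaybe-head-filter : ∀ {d} xs → P d → P (fromMaybe d (head (filter P? xs)))
    fromMaybe-head-filter []       pd = pd
    fromMaybe-head-filter (y ∷ ys) pd with P? y
    ... | yes py = py
    ... | no  _  = fromMaybe-head-filter ys pd

  module _ (s : A → A) where

    iterate-map : ∀ a l → iterate s (s a) l ≡ map s (iterate s a l)
    iterate-map a zero    = refl
    iterate-map a (suc l) = cong (s a ∷_) (iterate-map (s a) l)

    ∈-iterate-suc : ∀ {x} a l → x ∈ iterate s a l → x ∈ iterate s a (suc l)
    ∈-iterate-suc a (suc l) (here refl) = here refl
    ∈-iterate-suc a (suc l) (there x∈)  = there (∈-iterate-suc (s a) l x∈)

    ∈-iterate-step : ∀ {x} a l → x ∈ iterate s a l → s x ∈ iterate s (s a) l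
    ∈-iterate-step a l x∈ = subst (_ ∈_) (sym (iterate-map a l)) (∈-map⁺ s x∈)

    ∈-iterate-pred : ∀ {c} a l → c ∈ iterate s (s a) l → ∃ λ x → x ∈ iterate s a l × c ≡ s x
    ∈-iterate-pred a l c∈ = ∈-map⁻ s (subst (_ ∈_) (iterate-map a l) c∈)

    take-iterate : ∀ j l a → j ≤ l → take j (iterate s a l) ≡ iterate s a j
    take-iterate zero    l       a _         = refl
    take-iterate (suc j) (suc l) a (s≤s j≤l) = cong (a ∷_) (take-iterate j l (s a) j≤l)

  module _ (_≟A_ : DecidableEquality A) where

    length-remove-< : ∀ {y ys} → y ∈ ys → length (filter (λ z → ¬? (z ≟A y)) ys) < length ys
    length-remove-< {ys = ys} y∈ys =
      List.filter-notAll _ ys (Any.map (λ { refl z≢z → z≢z refl }) y∈ys)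

module _ {A B : Set} (_≟B_ : DecidableEquality B) {φ : A → B} where

  length-≤-injectiveOn : ∀ {xs ys} → Unique xs → (∀ {x} → x ∈ xs → φ x ∈ ys) →
    (∀ {x x′} → x ∈ xs → x′ ∈ xs → φ x ≡ φ x′ → x ≡ x′) → length xs ≤ length ys
  length-≤-injectiveOn {[]}     _          _   _   = z≤n
  length-≤-injectiveOn {x ∷ xs} {ys} (x∉xs ∷ u) mem inj =
    ℕ.<-≤-trans (s≤s (length-≤-injectiveOn u mem′ (λ m m′ → inj (there m) (there m′))))
                (length-remove-< _≟B_ (mem (here refl)))
    where
    mem′ : ∀ {x′} → x′ ∈ xs → φ x′ ∈ filter (λ z → ¬? (z ≟B φ x)) ys
    mem′ m = ∈-filter⁺ (λ z → ¬? (z ≟B φ x)) (mem (there m))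
                       (λ e → All.lookup x∉xs m (sym (inj (there m) (here refl) e)))

  length-<-injectiveOn : ∀ {xs ys y} → Unique xs → (∀ {x} → x ∈ xs → φ x ∈ ys) →
    (∀ {x x′} → x ∈ xs → x′ ∈ xs → φ x ≡ φ x′ → x ≡ x′) →
    y ∈ ys → (∀ {x} → x ∈ xs → φ x ≢ y) → length xs < length ys
  length-<-injectiveOn {ys = ys} {y} u mem inj y∈ys missed =
    ℕ.<-≤-trans (s≤s (length-≤-injectiveOn u (λ m → ∈-filter⁺ (λ z → ¬? (z ≟B y)) (mem m) (missed m)) inj))
                (length-remove-< _≟B_ y∈ys)

∸-suc-< : ∀ {m k} → k < m → m ∸ k ≡ suc (m ∸ suc k)
∸-suc-< {suc m} {zero}  _         = refl
∸-suc-< {suc m} {suc k} (s≤s k<m) = ∸-suc-< k<m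

module _ {A : Set} where

  sum-map-+ : (g h : A → ℕ) (xs : List A) →
    sum (map (λ x → g x + h x) xs) ≡ sum (map g xs) + sum (map h xs)
  sum-map-+ g h []       = refl
  sum-map-+ g h (x ∷ xs) =
    trans (cong (g x + h x +_) (sum-map-+ g h xs)) (interchange (g x) (h x) _ _)

  sum-map-∸ : (h : A → ℕ) (k : ℕ) (xs : List A) →
    sum (map (λ x → h x ∸ k) xs) ≡
    length (filter (λ x → suc k ≤? h x) xs) + sum (map (λ x → h x ∸ suc k) xs)
  sum-map-∸ h k []       = refl
  sum-map-∸ h k (x ∷ xs) with suc k ≤? h x
  ... | yes k<hx rewrite List.filter-accept (λ x → suc k ≤? h x) {xs = xs} k<hx
                       | ∸-suc-< k<hx | sum-map-∸ h k xs =
    cong suc (x∙yz≈y∙xz (h x ∸ suc k) (length (filter (λ x → suc k ≤? h x) xs)) _)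
  ... | no  k≮hx rewrite List.filter-reject (λ x → suc k ≤? h x) {xs = xs} k≮hx
                       | ℕ.m≤n⇒m∸n≡0 (ℕ.≤-pred (ℕ.≰⇒> k≮hx))
                       | ℕ.m≤n⇒m∸n≡0 (ℕ.m≤n⇒m≤1+n (ℕ.≤-pred (ℕ.≰⇒> k≮hx))) = sum-map-∸ h k xs

  ∈⇒≤-sum-map : (h : A → ℕ) {x : A} {xs : List A} → x ∈ xs → h x ≤ sum (map h xs)
  ∈⇒≤-sum-map h (here refl) = ℕ.m≤m+n _ _
  ∈⇒≤-sum-map h (there x∈)  = ℕ.≤-trans (∈⇒≤-sum-map h x∈) (ℕ.m≤n+m _ _)

-- Occurrences

module _ {n : ℕ} where

  occ-∷-≡ : (x : Fin (suc n)) (xs : List (Fin (suc n))) → occ (x ∷ xs) x ≡ suc (occ xs x)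
  occ-∷-≡ x xs = cong length (List.filter-accept (λ t → t ≟ x) {xs = xs} refl)

  occ-∷-≢ : ∀ {i x : Fin (suc n)} (xs : List (Fin (suc n))) → i ≢ x → occ (i ∷ xs) x ≡ occ xs x
  occ-∷-≢ xs i≢x = cong length (List.filter-reject (λ t → t ≟ _) {xs = xs} i≢x)

  occ-∷ : (i x : Fin (suc n)) (xs : List (Fin (suc n))) → occ (i ∷ xs) x ≡ occ (i ∷ []) x + occ xs x
  occ-∷ i x xs with i ≟ x
  ... | yes _ = refl
  ... | no  _ = refl

  occ-↭ : ∀ {xs ys} → xs ↭ ys → (x : Fin (suc n)) → occ xs x ≡ occ ys x
  occ-↭ xs↭ys x = ↭-length (filter-↭ (λ t → t ≟ x) xs↭ys)

  ∈⇒occ-pos : ∀ {x : Fin (suc n)} {xs} → x ∈ xs → 0 < occ xs x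
  ∈⇒occ-pos x∈xs = List.filter-some (λ t → t ≟ _) (Any.map sym x∈xs)

  occ-pos⇒∈ : ∀ {x : Fin (suc n)} xs → 0 < occ xs x → x ∈ xs
  occ-pos⇒∈ {x} (y ∷ xs) occ-pos with y ≟ x
  ... | yes refl = here refl
  ... | no  _    = there (occ-pos⇒∈ xs occ-pos)

  ∉⇒occ≡0 : ∀ {x : Fin (suc n)} xs → x ∉ xs → occ xs x ≡ 0
  ∉⇒occ≡0 xs x∉xs = ℕ.n≤0⇒n≡0 (ℕ.≮⇒≥ (x∉xs ∘′ occ-pos⇒∈ xs))

  ∈-resp-occ : ∀ {xs ys} {x : Fin (suc n)} → (∀ z → occ xs z ≡ occ ys z) → x ∈ xs → x ∈ ys
  ∈-resp-occ {ys = ys} {x} occ≡ x∈xs = occ-pos⇒∈ ys (subst (0 <_) (occ≡ x) (∈⇒occ-pos x∈xs))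

  occ-∷-cancel : (c : Fin (suc n)) {xs ys : List (Fin (suc n))} →
    (∀ z → occ (c ∷ xs) z ≡ occ (c ∷ ys) z) → ∀ z → occ xs z ≡ occ ys z
  occ-∷-cancel c {xs} {ys} occ≡ z =
    ℕ.+-cancelˡ-≡ (occ (c ∷ []) z) _ _ (trans (sym (occ-∷ c z xs)) (trans (occ≡ z) (occ-∷ c z ys)))

  occ≡0⇒≡[] : (xs : List (Fin (suc n))) → (∀ z → occ xs z ≡ 0) → xs ≡ []
  occ≡0⇒≡[] []       _     = refl
  occ≡0⇒≡[] (x ∷ xs) occ≡0 with () ← trans (sym (occ-∷-≡ x xs)) (occ≡0 x)

  Unique⇒occ≤1 : ∀ {xs} → Unique xs → (x : Fin (suc n)) → occ xs x ≤ 1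
  Unique⇒occ≤1 []                  x = z≤n
  Unique⇒occ≤1 {y ∷ xs} (y∉xs ∷ u) x with y ≟ x
  ... | yes refl rewrite ∉⇒occ≡0 xs (All¬⇒¬Any y∉xs) = s≤s z≤n
  ... | no  _    = Unique⇒occ≤1 u x

  Unique⇒occ≡1 : ∀ {xs} → Unique xs → {x : Fin (suc n)} → x ∈ xs → occ xs x ≡ 1
  Unique⇒occ≡1 u x∈xs = ℕ.≤-antisym (Unique⇒occ≤1 u _) (∈⇒occ-pos x∈xs)

  module _ {P : Pred (Fin (suc n)) 0ℓ} (P? : Decidable P) where

    occ-filter-accept : ∀ {x} xs → P x → occ (filter P? xs) x ≡ occ xs x
    occ-filter-accept {x} []       _  = refl
    occ-filter-accept {x} (y ∷ xs) px with P? y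
    ... | yes py = trans (occ-∷ y x (filter P? xs))
                     (trans (cong (occ (y ∷ []) x +_) (occ-filter-accept xs px)) (sym (occ-∷ y x xs)))
    ... | no ¬py = trans (occ-filter-accept xs px) (sym (occ-∷-≢ {i = y} xs λ { refl → ¬py px }))

    occ-filter-reject : ∀ {x} xs → ¬ P x → occ (filter P? xs) x ≡ 0
    occ-filter-reject []       _   = refl
    occ-filter-reject (y ∷ xs) ¬px with P? y
    ... | yes py = trans (occ-∷-≢ {i = y} (filter P? xs) λ { refl → ¬px py }) (occ-filter-reject xs ¬px)
    ... | no  _  = occ-filter-reject xs ¬px

  sum-occ : (xs : List (Fin (suc n))) → sum (map (occ xs) (allFin (suc n))) ≡ length xs
  sum-occ []       = sum-zeros (allFin (suc n))
    where
    sum-zeros : ∀ ys → sum (map (occ []) ys) ≡ 0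
    sum-zeros []       = refl
    sum-zeros (_ ∷ ys) = sum-zeros ys
  sum-occ (i ∷ xs) = begin
    sum (map (occ (i ∷ xs)) all)
      ≡⟨ cong sum (List.map-cong (λ x → occ-∷ i x xs) all) ⟩
    sum (map (λ x → occ (i ∷ []) x + occ xs x) all)
      ≡⟨ sum-map-+ (occ (i ∷ [])) (occ xs) all ⟩
    sum (map (occ (i ∷ [])) all) + sum (map (occ xs) all)
      ≡⟨ cong₂ _+_ (sum-map-occ-[] all) (sum-occ xs) ⟩
    occ all i + length xs
      ≡⟨ cong (_+ length xs) (Unique⇒occ≡1 (Unique.allFin⁺ (suc n)) (∈-allFin i)) ⟩
    suc (length xs)
      ∎
    where
    open ≡-Reasoning
    all = allFin (suc n)
    sum-map-occ-[] : ∀ ys → sum (map (occ (i ∷ [])) ys) ≡ occ ys i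
    sum-map-occ-[] []       = refl
    sum-map-occ-[] (y ∷ ys) with i ≟ y
    ... | yes refl = trans (cong suc (sum-map-occ-[] ys)) (sym (occ-∷-≡ i ys))
    ... | no  i≢y  = trans (sum-map-occ-[] ys) (sym (occ-∷-≢ ys (i≢y ∘′ sym)))

  module _ (s : Fin (suc n) → Fin (suc n)) where

    -- A letter of h out of place would occur after its own predecessor as well, hence twice.
    iterate-chain : ∀ l a {h} → Unique (iterate s a (suc l)) →
      (∀ z → occ h z ≡ occ (iterate s a (suc l)) z) →
      (∀ {x} → x ∈ iterate s a l → x ∷ s x ∷ [] ⊆ h) →
      h ≡ iterate s a (suc l)
    iterate-chain l a {[]} _ occ≡ _ with () ← trans (occ≡ a) (occ-∷-≡ a (iterate s (s a) l))
    iterate-chain l a {c ∷ h} (a∉ ∷ u) occ≡ steps with c ≟ a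
    iterate-chain zero    a {c ∷ h} (a∉ ∷ u) occ≡ steps | yes refl =
      cong (c ∷_) (occ≡0⇒≡[] h (occ-∷-cancel c occ≡))
    iterate-chain (suc l) a {c ∷ h} (a∉ ∷ u) occ≡ steps | yes refl =
      cong (c ∷_) (iterate-chain l (s c) u (occ-∷-cancel c occ≡) λ x∈ →
        ∷ʳ⁻ (λ { refl → All¬⇒¬Any a∉ (∈-iterate-suc s (s c) l x∈) }) (steps (there x∈)))
    ... | no c≢a with x , x∈ , refl ← ∈-iterate-pred s a l (Any.tail c≢a (∈-resp-occ occ≡ (here refl))) =
      ⊥-elim (ℕ.<⇒≱ (subst (1 <_) (trans (sym (occ-∷-≡ c h)) (occ≡ c))
                                   (s≤s (∈⇒occ-pos (to∈ (∷⁻ (steps x∈))))))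
                     (Unique⇒occ≤1 (a∉ ∷ u) c))

-- Words in star transpositions

module _ {n : ℕ} where

  star-self : (i : Fin (suc n)) → i ≢ zero → star i i ≡ zero
  star-self zero    i≢0 = ⊥-elim (i≢0 refl)
  star-self (suc k) _   with k ≟ k
  ... | yes _   = refl
  ... | no  k≢k = ⊥-elim (k≢k refl)

  star-other : (i x : Fin (suc n)) → x ≢ zero → x ≢ i → star i x ≡ x
  star-other i zero    x≢0 _   = ⊥-elim (x≢0 refl)
  star-other i (suc k) _   x≢i with suc k ≟ i
  ... | yes x≡i = ⊥-elim (x≢i x≡i)
  ... | no  _   = refl

  star-≢ : (i a : Fin (suc n)) {z : Fin (suc n)} → i ≢ z → z ≢ zero → a ≢ z → star i a ≢ z
  star-≢ i a i≢z z≢0 a≢z with a ≟ zero | a ≟ i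
  ... | yes refl | _        = i≢z
  ... | no  _    | yes refl = z≢0 ∘′ sym
  ... | no  _    | no  _    = a≢z

  run : List (Fin (suc n)) → Fin (suc n) → Fin (suc n)
  run []      a = a
  run (i ∷ w) a = run w (star i a)

  prod≡run-reverse : (f : List (Fin (suc n))) (x : Fin (suc n)) → prod f x ≡ run (reverse f) x
  prod≡run-reverse []      x = refl
  prod≡run-reverse (i ∷ f) x = begin
    star i (prod f x)          ≡⟨ cong (star i) (prod≡run-reverse f x) ⟩
    star i (run (reverse f) x) ≡⟨ run-∷ʳ (reverse f) x ⟨
    run (reverse f ∷ʳ i) x     ≡⟨ cong (λ w → run w x) (List.unfold-reverse i f) ⟨
    run (reverse (i ∷ f)) x    ∎
    where
    open ≡-Reasoning
    run-∷ʳ : ∀ w a → run (w ∷ʳ i) a ≡ star i (run w a)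
    run-∷ʳ []      a = refl
    run-∷ʳ (j ∷ w) a = run-∷ʳ w (star j a)

  run-moves⇒∈ : ∀ w {a : Fin (suc n)} → a ≢ zero → run w a ≢ a → a ∈ w
  run-moves⇒∈ []      a≢0 moved = ⊥-elim (moved refl)
  run-moves⇒∈ (i ∷ w) {a} a≢0 moved with i ≟ a
  ... | yes refl = here refl
  ... | no  i≢a  =
    there (run-moves⇒∈ w a≢0 (subst (λ b → run w b ≢ a) (star-other i a a≢0 (i≢a ∘′ sym)) moved))

  run-reaches⇒∈ : ∀ w {a z : Fin (suc n)} → z ≢ zero → a ≢ z → run w a ≡ z → z ∈ w
  run-reaches⇒∈ []      _   a≢z a≡z = ⊥-elim (a≢z a≡z)
  run-reaches⇒∈ (i ∷ w) {a} {z} z≢0 a≢z run≡z with i ≟ z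
  ... | yes refl = here refl
  ... | no  i≢z  = there (run-reaches⇒∈ w z≢0 (star-≢ i a i≢z z≢0 a≢z) run≡z)

  -- The first (1 x) sends x to 1, and then only a later (1 z) can take 1 to z.
  run-⊆ : ∀ w {x z : Fin (suc n)} → x ≢ zero → z ≢ zero → x ∈ w → run w x ≡ z → x ∷ z ∷ [] ⊆ w
  run-⊆ (i ∷ w) {x} x≢0 z≢0 x∈ run≡z with i ≟ x
  ... | yes refl = refl ∷ from∈ (run-reaches⇒∈ w z≢0 (z≢0 ∘′ sym)
                                   (trans (cong (run w) (sym (star-self i x≢0))) run≡z))
  ... | no  i≢x  = i Sublist.∷ʳ run-⊆ w x≢0 z≢0 (Any.tail (i≢x ∘′ sym) x∈)
                                   (trans (cong (run w) (sym (star-other i x x≢0 (i≢x ∘′ sym)))) run≡z)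

-- Orbits of a permutation

module Orbit {N : ℕ} (π : Permutation′ N) where

  next : Fin N → Fin N
  next x = π ⟨$⟩ʳ x

  next-injective : ∀ {x y} → next x ≡ next y → x ≡ y
  next-injective e = trans (sym (inverseˡ π)) (trans (cong (π ⟨$⟩ˡ_) e) (inverseˡ π))

  iter-suc : ∀ k x → iter π (suc k) x ≡ iter π k (next x)
  iter-suc zero    x = refl
  iter-suc (suc k) x = cong next (iter-suc k x)

  iter-+ : ∀ k j x → iter π (k + j) x ≡ iter π k (iter π j x)
  iter-+ zero    j x = refl
  iter-+ (suc k) j x = cong next (iter-+ k j x)

  iter-cancel : ∀ i j x → iter π i x ≡ iter π j x → i ≤ j → iter π (j ∸ i) x ≡ x
  iter-cancel zero    j       x e _         = sym e
  iter-cancel (suc i) (suc j) x e (s≤s i≤j) = iter-cancel i j x (next-injective e) i≤j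

  period : ∀ x → ∃ λ q → q < N × iter π (suc q) x ≡ x
  period x with i , j , i<j , eq ← Fin.pigeonhole (ℕ.n<1+n N) (λ k → iter π (toℕ k) x) =
    positive (toℕ j ∸ toℕ i) (ℕ.m<n⇒0<n∸m i<j)
             (ℕ.≤-trans (ℕ.m∸n≤m (toℕ j) (toℕ i)) (ℕ.≤-pred (Fin.toℕ<n j)))
             (iter-cancel (toℕ i) (toℕ j) x eq (ℕ.<⇒≤ i<j))
    where
    positive : ∀ d → 0 < d → d ≤ N → iter π d x ≡ x → ∃ λ q → q < N × iter π (suc q) x ≡ x
    positive (suc q) _ q<N eq = q , q<N , eq

  iter-reduce : ∀ {q x} → iter π (suc q) x ≡ x → ∀ k → ∃ λ r → r ≤ q × iter π k x ≡ iter π r x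
  iter-reduce per zero = zero , z≤n , refl
  iter-reduce {q} per (suc k) with iter-reduce per k
  ... | r , r≤q , eq with r ℕ.≟ q
  ...   | yes refl = zero , z≤n , trans (cong next eq) per
  ...   | no  r≢q  = suc r , ℕ.≤∧≢⇒< r≤q r≢q , cong next eq

  iter-Fin : ∀ x k → ∃ λ (r : Fin N) → iter π k x ≡ iter π (toℕ r) x
  iter-Fin x k with period x
  ... | q , q<N , per with iter-reduce per k
  ... | r , r≤q , eq = fromℕ< r<N , trans eq (cong (λ t → iter π t x) (sym (Fin.toℕ-fromℕ< r<N)))
    where r<N = ℕ.≤-<-trans r≤q q<N

  Reach : Fin N → Fin N → Set
  Reach x y = ∃ λ k → iter π k x ≡ y

  Reach-refl : ∀ {x} → Reach x x
  Reach-refl = zero , refl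

  Reach-trans : ∀ {x y z} → Reach x y → Reach y z → Reach x z
  Reach-trans {x} (k , refl) (j , refl) = j + k , iter-+ j k x

  Reach-sym : ∀ {x y} → Reach x y → Reach y x
  Reach-sym {x} (k , refl) with period x
  ... | q , _ , per with iter-reduce per k
  ... | r , r≤q , eq = suc q ∸ r , (begin
    iter π (suc q ∸ r) (iter π k x) ≡⟨ cong (iter π (suc q ∸ r)) eq ⟩
    iter π (suc q ∸ r) (iter π r x) ≡⟨ iter-+ (suc q ∸ r) r x ⟨
    iter π (suc q ∸ r + r) x        ≡⟨ cong (λ t → iter π t x) (ℕ.m∸n+n≡m (ℕ.m≤n⇒m≤1+n r≤q)) ⟩
    iter π (suc q) x                ≡⟨ per ⟩
    x                               ∎)
    where open ≡-Reasoning

  Reach-pred : ∀ {x c} → Reach x c → ∃ λ y → Reach x y × next y ≡ c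
  Reach-pred {c = c} x↝c with q , _ , per ← period c = iter π q c , Reach-trans x↝c (q , refl) , per

  Reach? : ∀ x → Decidable (Reach x)
  Reach? x y = map′ (λ (r , eq) → toℕ r , eq)
                    (λ (k , eq) → let r , eq′ = iter-Fin x k in r , trans (sym eq′) eq)
                    (Fin.any? (λ r → iter π (toℕ r) x ≟ y))

  leader-≤ : ∀ {L y} → CycleLeader π L → Reach L y → toℕ L ≤ toℕ y
  leader-≤ {L} lead (k , refl) with r , eq ← iter-Fin L k = subst (λ t → toℕ L ≤ toℕ t) (sym eq) (lead r)

  leader-unique : ∀ {L L′} → CycleLeader π L → CycleLeader π L′ → Reach L L′ → L ≡ L′
  leader-unique lead lead′ L↝L′ =
    Fin.toℕ-injective (ℕ.≤-antisym (leader-≤ lead L↝L′) (leader-≤ lead′ (Reach-sym L↝L′)))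

  iterate-++ : ∀ a k m → iterate next a (k + m) ≡ iterate next a k ++ iterate next (iter π k a) m
  iterate-++ a zero    m = refl
  iterate-++ a (suc k) m = cong (a ∷_) (trans (iterate-++ (next a) k m)
    (cong (λ b → iterate next (next a) k ++ iterate next b m) (sym (iter-suc k a))))

  iterate-∷ʳ : ∀ a l → iterate next a (suc l) ≡ iterate next a l ∷ʳ iter π l a
  iterate-∷ʳ a l = trans (cong (iterate next a) (ℕ.+-comm 1 l)) (iterate-++ a l 1)

  drop-iterate : ∀ j l a → j ≤ l → drop j (iterate next a l) ≡ iterate next (iter π j a) (l ∸ j)
  drop-iterate zero    l       a _         = refl
  drop-iterate (suc j) (suc l) a (s≤s j≤l) =
    trans (drop-iterate j l (next a) j≤l) (cong (λ b → iterate next b (l ∸ j)) (sym (iter-suc j a)))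

  ∈-iterate⇒Reach : ∀ {x} a l → x ∈ iterate next a l → Reach a x
  ∈-iterate⇒Reach a (suc l) (here refl) = Reach-refl
  ∈-iterate⇒Reach a (suc l) (there x∈)  = Reach-trans (1 , refl) (∈-iterate⇒Reach (next a) l x∈)

  lookup-iterate : ∀ {a l} (xs : List (Fin N)) → xs ≡ iterate next a l →
    (j : Fin (length xs)) → lookup xs j ≡ iter π (toℕ j) a
  lookup-iterate {a} {suc l} (x ∷ xs) refl zero    = refl
  lookup-iterate {a} {suc l} (x ∷ xs) refl (suc j) =
    trans (lookup-iterate {next a} {l} xs refl j) (sym (iter-suc (toℕ j) a))

  iter-periodic : ∀ {l a} j → iter π l a ≡ a → iter π l (iter π j a) ≡ iter π j a
  iter-periodic {l} {a} j per = begin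
    iter π l (iter π j a) ≡⟨ iter-+ l j a ⟨
    iter π (l + j) a      ≡⟨ cong (λ k → iter π k a) (ℕ.+-comm l j) ⟩
    iter π (j + l) a      ≡⟨ iter-+ j l a ⟩
    iter π j (iter π l a) ≡⟨ cong (iter π j) per ⟩
    iter π j a            ∎
    where open ≡-Reasoning

  iterate-rotate : ∀ {l a} j → iter π l a ≡ a → j ≤ l →
    drop j (iterate next a l) ++ take j (iterate next a l) ≡ iterate next (iter π j a) l
  iterate-rotate {l} {a} j per j≤l = begin
    drop j (iterate next a l) ++ take j (iterate next a l)
      ≡⟨ cong₂ _++_ (drop-iterate j l a j≤l) (take-iterate next j l a j≤l) ⟩
    iterate next d (l ∸ j) ++ iterate next a j
      ≡⟨ cong (λ b → iterate next d (l ∸ j) ++ iterate next b j) d↝a ⟨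
    iterate next d (l ∸ j) ++ iterate next (iter π (l ∸ j) d) j
      ≡⟨ iterate-++ d (l ∸ j) j ⟨
    iterate next d (l ∸ j + j)
      ≡⟨ cong (iterate next d) (ℕ.m∸n+n≡m j≤l) ⟩
    iterate next d l
      ∎
    where
    open ≡-Reasoning
    d = iter π j a
    d↝a : iter π (l ∸ j) d ≡ a
    d↝a = trans (sym (iter-+ (l ∸ j) j a)) (trans (cong (λ k → iter π k a) (ℕ.m∸n+n≡m j≤l)) per)

  iterate-next-↭ : ∀ {l a} → iter π l a ≡ a → iterate next (next a) l ↭ iterate next a l
  iterate-next-↭ {l} {a} per = drop-∷ (begin
    a ∷ iterate next (next a) l    ≡⟨ iterate-∷ʳ a l ⟩
    iterate next a l ∷ʳ iter π l a ≡⟨ cong (iterate next a l ∷ʳ_) per ⟩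
    iterate next a l ∷ʳ a          ↭⟨ ∷↭∷ʳ a (iterate next a l) ⟨
    a ∷ iterate next a l           ∎)
    where open PermutationReasoning

  IsCycle⇒iterate : ∀ {a as} → IsCycle π (a ∷ as) →
    a ∷ as ≡ iterate next a (length (a ∷ as)) × iter π (length (a ∷ as)) a ≡ a
  IsCycle⇒iterate (_ , closes) = Closes⇒iterate _ closes
    where
    Closes⇒iterate : ∀ {a x} xs → Closes π a (x ∷ xs) →
      x ∷ xs ≡ iterate next x (length (x ∷ xs)) × iter π (length (x ∷ xs)) x ≡ a
    Closes⇒iterate []       next≡a = refl , next≡a
    Closes⇒iterate {x = x} (y ∷ xs) (refl , closes) with Closes⇒iterate xs closes
    ... | ys≡ , per = cong (x ∷_) ys≡ , trans (iter-suc (length (y ∷ xs)) x) per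

  IsCycle-Reach : ∀ {a as x} → IsCycle π (a ∷ as) → x ∈ a ∷ as → Reach a x
  IsCycle-Reach {a} {as} {x} cyc x∈ =
    ∈-iterate⇒Reach a (length (a ∷ as)) (subst (x ∈_) (proj₁ (IsCycle⇒iterate cyc)) x∈)

  IsCycle-pred : ∀ {σ c} → IsCycle π σ → c ∈ σ → ∃ λ x → x ∈ σ × next x ≡ c
  IsCycle-pred {a ∷ as} {c} cyc c∈σ with IsCycle⇒iterate cyc
  ... | σ≡ , per with ∈-iterate-pred next a (length (a ∷ as))
                        (∈-resp-↭ (↭-sym (iterate-next-↭ per)) (subst (c ∈_) σ≡ c∈σ))
  ... | x , x∈ , refl = x , subst (x ∈_) (sym σ≡) x∈ , refl

  lookup-cycle : ∀ {a as} → IsCycle π (a ∷ as) → (j : Fin (length (a ∷ as))) →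
    lookup (a ∷ as) j ≡ iter π (toℕ j) a
  lookup-cycle cyc = lookup-iterate _ (proj₁ (IsCycle⇒iterate cyc))

  cycle-period : ∀ {σ} → IsCycle π σ → (j : Fin (length σ)) → iter π (length σ) (lookup σ j) ≡ lookup σ j
  cycle-period {a ∷ as} cyc j rewrite lookup-cycle cyc j =
    iter-periodic {length (a ∷ as)} (toℕ j) (proj₂ (IsCycle⇒iterate cyc))

  rotate-cycle : ∀ {σ} → IsCycle π σ → (j : Fin (length σ)) →
    drop (toℕ j) σ ++ take (toℕ j) σ ≡ iterate next (lookup σ j) (length σ)
  rotate-cycle {a ∷ as} cyc j with σ≡ , per ← IsCycle⇒iterate cyc rewrite lookup-cycle cyc j =
    trans (cong (λ xs → drop (toℕ j) xs ++ take (toℕ j) xs) σ≡)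
          (iterate-rotate (toℕ j) per (ℕ.<⇒≤ (Fin.toℕ<n j)))

-- Minimal transitive star factorizations

module MinimalStarFactorization {n : ℕ} {π : Permutation′ (suc n)} {f : List (Fin (suc n))}
                                (min-fact : IsMinTransStarFact π f) where

  open Orbit π
  open import Data.List.Membership.DecPropositional (_≟_ {suc n}) using (_∈?_)

  g : List (Fin (suc n))
  g = reverse f

  zero∉f : zero ∉ f
  zero∉f 0∈f = All.lookup (proj₁ (proj₁ min-fact)) 0∈f refl

  nonzero∈f : ∀ {x} → x ≢ zero → x ∈ f
  nonzero∈f {x} x≢0 with w , w⊆f , w·x≡0 ← proj₁ (proj₂ min-fact) x zero =
    All.lookup w⊆f (∈-resp-↭ (↭-reverse w) (run-moves⇒∈ (reverse w) x≢0 λ run≡x →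
      x≢0 (trans (sym run≡x) (trans (sym (prod≡run-reverse w x)) w·x≡0))))

  zero∉g : zero ∉ g
  zero∉g = zero∉f ∘′ ∈-resp-↭ (↭-reverse f)

  nonzero∈g : ∀ {x} → x ≢ zero → x ∈ g
  nonzero∈g x≢0 = ∈-resp-↭ (↭-sym (↭-reverse f)) (nonzero∈f x≢0)

  run-g : ∀ x → run g x ≡ next x
  run-g x = trans (sym (prod≡run-reverse f x)) (proj₂ (proj₁ min-fact) x)

  occ-g : ∀ x → occ g x ≡ occ f x
  occ-g = occ-↭ (↭-reverse f)

  step-⊆ : ∀ {P : Pred (Fin (suc n)) 0ℓ} (P? : Decidable P) {x} → P x → P (next x) →
    x ≢ zero → next x ≢ zero → x ∷ next x ∷ [] ⊆ filter P? g
  step-⊆ P? px pnx x≢0 nx≢0 =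
    subst (_⊆ filter P? g) (List.filter-all P? (px ∷ pnx ∷ []))
      (filter⁺ P? P? (λ { refl p → p }) (run-⊆ g x≢0 nx≢0 (nonzero∈g x≢0) (run-g _)))

  -- The predecessor x of c was met before some occurrence of c, which is therefore not the first.
  head-doubled : ∀ {P : Pred (Fin (suc n)) 0ℓ} (P? : Decidable P) {c t} → filter P? g ≡ c ∷ t →
    ∀ {x} → P x → x ≢ zero → c ≢ zero → next x ≡ c → 2 ≤ occ f c
  head-doubled {P} P? {c} {t} eq {x} px x≢0 c≢0 refl = begin
    2                   ≤⟨ s≤s (∈⇒occ-pos (to∈ (∷⁻ (subst (_ ⊆_) eq (step-⊆ P? px pc x≢0 c≢0))))) ⟩
    suc (occ t c)       ≡⟨ occ-∷-≡ c t ⟨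
    occ (c ∷ t) c       ≡⟨ cong (λ h → occ h c) eq ⟨
    occ (filter P? g) c ≡⟨ occ-filter-accept P? g pc ⟩
    occ g c             ≡⟨ occ-g c ⟩
    occ f c             ∎
    where
    open ℕ.≤-Reasoning
    pc : P c
    pc = proj₂ (∈-filter⁻ P? {xs = g} (subst (c ∈_) (sym eq) (here refl)))

  nonzeros : List (Fin (suc n))
  nonzeros = tabulate suc

  nonzero∈nonzeros : ∀ {x} → x ≢ zero → x ∈ nonzeros
  nonzero∈nonzeros {zero}  x≢0 = ⊥-elim (x≢0 refl)
  nonzero∈nonzeros {suc k} _   = ∈-tabulate⁺ k

  ∈nonzeros⇒nonzero : ∀ {x} → x ∈ nonzeros → x ≢ zero
  ∈nonzeros⇒nonzero x∈ with ∈-tabulate⁻ x∈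
  ... | _ , refl = λ ()

  -- Syntactically the decision procedure of numCycles, so that length-f can unfold it.
  leader? : Decidable (CycleLeader π)
  leader? x = Fin.all? (λ k → toℕ x ℕ.≤? toℕ (iter π (toℕ k) x))

  zero-leader : CycleLeader π zero
  zero-leader _ = z≤n

  leaders : List (Fin (suc n))
  leaders = filter leader? nonzeros

  doubled : List (Fin (suc n))
  doubled = filter (λ x → 2 ≤? occ f x) nonzeros

  excess : ℕ
  excess = sum (map (λ x → occ f x ∸ 2) nonzeros)

  length-f : length f ≡ n + length leaders
  length-f = begin
    length f                         ≡⟨ proj₂ (proj₂ min-fact) ⟩
    suc n + numCycles π ∸ 2          ≡⟨ cong (λ m → suc n + m ∸ 2) numCycles≡ ⟩
    suc n + suc (length leaders) ∸ 2 ≡⟨ cong (_∸ 1) (ℕ.+-suc n (length leaders)) ⟩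
    n + length leaders               ∎
    where
    open ≡-Reasoning
    numCycles≡ = cong length (List.filter-accept leader? {xs = nonzeros} zero-leader)

  length-f-by-occ : length f ≡ n + (length doubled + excess)
  length-f-by-occ = begin
    length f
      ≡⟨ sum-occ f ⟨
    occ f zero + sum (map (occ f) nonzeros)
      ≡⟨ cong (_+ sum (map (occ f) nonzeros)) (∉⇒occ≡0 f zero∉f) ⟩
    sum (map (occ f) nonzeros)
      ≡⟨ sum-map-∸ (occ f) 0 nonzeros ⟩
    length (filter (λ x → 1 ≤? occ f x) nonzeros) + sum (map (λ x → occ f x ∸ 1) nonzeros)
      ≡⟨ cong₂ _+_ all-occur (sum-map-∸ (occ f) 1 nonzeros) ⟩
    n + (length doubled + excess)
      ∎
    where
    open ≡-Reasoning
    all-occur : length (filter (λ x → 1 ≤? occ f x) nonzeros) ≡ n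
    all-occur = trans (cong length (List.filter-all (λ x → 1 ≤? occ f x)
                        (All.tabulate λ x∈ → ∈⇒occ-pos (nonzero∈f (∈nonzeros⇒nonzero x∈)))))
                      (List.length-tabulate suc)

  length-leaders : length leaders ≡ length doubled + excess
  length-leaders = ℕ.+-cancelˡ-≡ n _ _ (trans (sym length-f) length-f-by-occ)

  -- The first symbol of the cycle of L met by the factors (L itself if there is none).
  firstMet : Fin (suc n) → Fin (suc n)
  firstMet L = fromMaybe L (head (filter (Reach? L) g))

  Reach-firstMet : ∀ L → Reach L (firstMet L)
  Reach-firstMet L = fromMaybe-head-filter (Reach? L) g Reach-refl

  ∈leaders⇒leader : ∀ {L} → L ∈ leaders → CycleLeader π L
  ∈leaders⇒leader L∈ = proj₂ (∈-filter⁻ leader? {xs = nonzeros} L∈)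

  leader-avoids-zero : ∀ {L} → L ∈ leaders → ∀ {x} → Reach L x → x ≢ zero
  leader-avoids-zero L∈ L↝x refl =
    ∈nonzeros⇒nonzero (proj₁ (∈-filter⁻ leader? {xs = nonzeros} L∈))
                      (leader-unique (∈leaders⇒leader L∈) zero-leader L↝x)

  firstMet-doubled : ∀ {L} → L ∈ leaders → 2 ≤ occ f (firstMet L)
  firstMet-doubled {L} L∈ =
    via-first (filter-∷ (Reach? L) (nonzero∈g (leader-avoids-zero L∈ Reach-refl)) Reach-refl)
    where
    via-first : (∃₂ λ c t → filter (Reach? L) g ≡ c ∷ t × Reach L c) → 2 ≤ occ f (firstMet L)
    via-first (c , t , eq , L↝c) =
      let y , L↝y , next-y≡c = Reach-pred L↝c in
      subst (λ x → 2 ≤ occ f x) (sym (cong (fromMaybe L ∘′ head) eq))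
        (head-doubled (Reach? L) eq L↝y (leader-avoids-zero L∈ L↝y) (leader-avoids-zero L∈ L↝c) next-y≡c)

  doubled⇒nonzero : ∀ {x} → 2 ≤ occ f x → x ≢ zero
  doubled⇒nonzero 2≤occ refl with () ← subst (2 ≤_) (∉⇒occ≡0 f zero∉f) 2≤occ

  firstMet∈doubled : ∀ {L} → L ∈ leaders → firstMet L ∈ doubled
  firstMet∈doubled L∈ = ∈-filter⁺ (λ x → 2 ≤? occ f x)
    (nonzero∈nonzeros (doubled⇒nonzero (firstMet-doubled L∈))) (firstMet-doubled L∈)

  firstMet-injective : ∀ {L L′} → L ∈ leaders → L′ ∈ leaders → firstMet L ≡ firstMet L′ → L ≡ L′
  firstMet-injective {L} {L′} L∈ L′∈ eq = leader-unique (∈leaders⇒leader L∈) (∈leaders⇒leader L′∈)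
    (Reach-trans (Reach-firstMet L) (subst (λ y → Reach y L′) (sym eq) (Reach-sym (Reach-firstMet L′))))

  leaders-unique : Unique leaders
  leaders-unique = Unique.filter⁺ leader? (Unique.tabulate⁺ Fin.suc-injective)

  -- The injection firstMet : leaders → doubled, together with length-leaders, leaves room
  -- neither for excess nor for doubled symbols outside its image.
  excess≡0 : excess ≡ 0
  excess≡0 = ℕ.n≤0⇒n≡0 (ℕ.+-cancelˡ-≤ (length doubled) _ _
    (subst (_≤ length doubled + 0) length-leaders
      (subst (length leaders ≤_) (sym (ℕ.+-identityʳ _))
        (length-≤-injectiveOn _≟_ leaders-unique firstMet∈doubled firstMet-injective))))

  occ≤2 : ∀ x → occ f x ≤ 2
  occ≤2 zero    = subst (_≤ 2) (sym (∉⇒occ≡0 f zero∉f)) z≤n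
  occ≤2 (suc k) = ℕ.m∸n≡0⇒m≤n (ℕ.n≤0⇒n≡0 (subst (occ f (suc k) ∸ 2 ≤_) excess≡0
                    (∈⇒≤-sum-map (λ x → occ f x ∸ 2) (∈-tabulate⁺ k))))

  doubled⇒firstMet : ∀ {y} → 2 ≤ occ f y → ∃ λ L → L ∈ leaders × firstMet L ≡ y
  doubled⇒firstMet {y} 2≤occ = decide (Any.any? (λ L → firstMet L ≟ y) leaders)
    where
    decide : Dec (Any (λ L → firstMet L ≡ y) leaders) → ∃ λ L → L ∈ leaders × firstMet L ≡ y
    decide (yes hit)  = find hit
    decide (no  miss) = ⊥-elim (ℕ.<⇒≱
      (length-<-injectiveOn _≟_ leaders-unique firstMet∈doubled firstMet-injective
         (∈-filter⁺ (λ x → 2 ≤? occ f x) (nonzero∈nonzeros (doubled⇒nonzero 2≤occ)) 2≤occ)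
         (λ L∈ hit → miss (lose L∈ hit)))
      (subst (length doubled ≤_) (sym length-leaders) (ℕ.m≤m+n _ _)))

  doubled-unique : ∀ {a y y′} → Reach a y → Reach a y′ → 2 ≤ occ f y → 2 ≤ occ f y′ → y ≡ y′
  doubled-unique a↝y a↝y′ 2≤occ 2≤occ′ =
    let L  , L∈  , firstMet≡y  = doubled⇒firstMet 2≤occ
        L′ , L′∈ , firstMet≡y′ = doubled⇒firstMet 2≤occ′
        L↝a  = Reach-trans (subst (Reach L) firstMet≡y (Reach-firstMet L)) (Reach-sym a↝y)
        a↝L′ = Reach-trans a↝y′ (Reach-sym (subst (Reach L′) firstMet≡y′ (Reach-firstMet L′)))
    in trans (sym firstMet≡y)
         (trans (cong firstMet (leader-unique (∈leaders⇒leader L∈) (∈leaders⇒leader L′∈)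
                                              (Reach-trans L↝a a↝L′)))
                firstMet≡y′)

  not-doubled-with-zero : ∀ {y} → Reach zero y → ¬ 2 ≤ occ f y
  not-doubled-with-zero 0↝y 2≤occ =
    let L , L∈ , firstMet≡y = doubled⇒firstMet 2≤occ
    in leader-avoids-zero L∈
         (Reach-trans (subst (Reach L) firstMet≡y (Reach-firstMet L)) (Reach-sym 0↝y)) refl

  occ≡1 : ∀ {x} → x ≢ zero → ¬ 2 ≤ occ f x → occ f x ≡ 1
  occ≡1 x≢0 ¬2≤occ = ℕ.≤-antisym (ℕ.≤-pred (ℕ.≰⇒> ¬2≤occ)) (∈⇒occ-pos (nonzero∈f x≢0))

  occ-meeting-∈ : ∀ {σ z} → z ∈ σ → occ (meeting f σ) z ≡ occ f z
  occ-meeting-∈ {σ} z∈σ = trans (occ-filter-accept (_∈? σ) g z∈σ) (occ-g _)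

  occ-meeting-∉ : ∀ {σ z} → z ∉ σ → occ (meeting f σ) z ≡ 0
  occ-meeting-∉ {σ} z∉σ = occ-filter-reject (_∈? σ) g z∉σ

  meeting-cycle-of-zero : ∀ {σ} → IsCycle π σ → ∀ bs → σ ≡ zero ∷ bs →
    All (λ b → occ f b ≡ 1) bs × meeting f σ ≡ bs
  meeting-cycle-of-zero _ [] refl =
    [] , List.filter-none (_∈? (zero ∷ [])) (All.tabulate λ { x∈g (here refl) → zero∉g x∈g })
  meeting-cycle-of-zero cyc@(0∉ ∷ u , _) (b ∷ bs) refl =
    All.tabulate occ≡1-bs ,
    trans (iterate-chain next (length bs) (next zero) (subst Unique bs≡ u)
            (λ z → trans (occ-meeting z) (cong (λ xs → occ xs z) bs≡)) steps)
          (sym bs≡)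
    where
    σ = zero ∷ b ∷ bs
    bs≡ : b ∷ bs ≡ iterate next (next zero) (length (b ∷ bs))
    bs≡ = List.∷-injectiveʳ (proj₁ (IsCycle⇒iterate cyc))
    nonzero : ∀ {x} → x ∈ b ∷ bs → x ≢ zero
    nonzero x∈ refl = All¬⇒¬Any 0∉ x∈
    occ≡1-bs : ∀ {x} → x ∈ b ∷ bs → occ f x ≡ 1
    occ≡1-bs x∈ = occ≡1 (nonzero x∈) (not-doubled-with-zero (IsCycle-Reach cyc (there x∈)))
    occ-meeting : ∀ z → occ (meeting f σ) z ≡ occ (b ∷ bs) z
    occ-meeting z = by-membership (z ∈? σ)
      where
      by-membership : ∀ {z} → Dec (z ∈ σ) → occ (meeting f σ) z ≡ occ (b ∷ bs) z
      by-membership (no  z∉σ)          = trans (occ-meeting-∉ z∉σ) (sym (∉⇒occ≡0 _ (z∉σ ∘′ there)))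
      by-membership (yes (here refl))  =
        trans (occ-meeting-∈ (here refl)) (trans (∉⇒occ≡0 f zero∉f) (sym (∉⇒occ≡0 _ (All¬⇒¬Any 0∉))))
      by-membership (yes (there z∈bs)) =
        trans (occ-meeting-∈ (there z∈bs)) (trans (occ≡1-bs z∈bs) (sym (Unique⇒occ≡1 u z∈bs)))
    steps : ∀ {x} → x ∈ iterate next (next zero) (length bs) → x ∷ next x ∷ [] ⊆ meeting f σ
    steps {x} x∈ = step-⊆ (_∈? σ) (there x∈bs) (there nx∈bs) (nonzero x∈bs) (nonzero nx∈bs)
      where
      x∈bs : x ∈ b ∷ bs
      x∈bs = subst (x ∈_) (sym bs≡) (∈-iterate-suc next (next zero) (length bs) x∈)
      nx∈bs : next x ∈ b ∷ bs
      nx∈bs = subst (next x ∈_) (sym bs≡) (there (∈-iterate-step next (next zero) (length bs) x∈))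

  cycle-doubled-unique : ∀ {σ x y} → IsCycle π σ → x ∈ σ → y ∈ σ → 2 ≤ occ f x → 2 ≤ occ f y → x ≡ y
  cycle-doubled-unique {_ ∷ _} cyc x∈ y∈ = doubled-unique (IsCycle-Reach cyc x∈) (IsCycle-Reach cyc y∈)

  meeting-head-doubled : ∀ {σ} → IsCycle π σ → zero ∉ σ →
    ∃₂ λ c t → meeting f σ ≡ c ∷ t × c ∈ σ × 2 ≤ occ f c
  meeting-head-doubled {σ@(a ∷ _)} cyc 0∉σ =
    let c , t , eq , c∈σ = filter-∷ (_∈? σ) (nonzero∈g (∈∧∉⇒≢ (here refl) 0∉σ)) (here refl)
        x , x∈σ , next-x≡c = IsCycle-pred cyc c∈σ
    in c , t , eq , c∈σ , head-doubled (_∈? σ) eq x∈σ (∈∧∉⇒≢ x∈σ 0∉σ) (∈∧∉⇒≢ c∈σ 0∉σ) next-x≡c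

  cycle-one-doubled : ∀ {σ} → IsCycle π σ → zero ∉ σ →
    ∃ λ (j : Fin (length σ)) → occ f (lookup σ j) ≡ 2 × (∀ i → i ≢ j → occ f (lookup σ i) ≡ 1)
  cycle-one-doubled {σ@(_ ∷ _)} cyc@(u , _) 0∉σ =
    let c , _ , _ , c∈σ , c-doubled = meeting-head-doubled cyc 0∉σ
        c≡ = lookup-index c∈σ
    in Any.index c∈σ ,
       trans (cong (occ f) (sym c≡)) (ℕ.≤-antisym (occ≤2 c) c-doubled) ,
       λ i i≢j → occ≡1 (∈∧∉⇒≢ (∈-lookup i) 0∉σ) λ 2≤occ →
         i≢j (Unique-lookup-injective u i _
               (trans (cycle-doubled-unique cyc (∈-lookup i) c∈σ 2≤occ c-doubled) c≡))

  occ-meeting-cycle : ∀ {σ} → IsCycle π σ → zero ∉ σ → ∀ j → occ f (lookup σ j) ≡ 2 →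
    ∀ z → occ (meeting f σ) z ≡ occ (lookup σ j ∷ σ) z
  occ-meeting-cycle {σ@(_ ∷ _)} cyc@(u , _) 0∉σ j occ≡2 z = by-cases (z ∈? σ) (z ≟ lookup σ j)
    where
    d = lookup σ j
    by-cases : ∀ {z} → Dec (z ∈ σ) → Dec (z ≡ d) → occ (meeting f σ) z ≡ occ (d ∷ σ) z
    by-cases (no z∉σ) _ =
      trans (occ-meeting-∉ z∉σ)
        (sym (trans (occ-∷-≢ {i = d} σ (λ { refl → z∉σ (∈-lookup j) })) (∉⇒occ≡0 σ z∉σ)))
    by-cases (yes z∈σ) (yes refl) =
      trans (occ-meeting-∈ z∈σ) (trans occ≡2 (sym (trans (occ-∷-≡ d σ) (cong suc (Unique⇒occ≡1 u z∈σ)))))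
    by-cases (yes z∈σ) (no z≢d) =
      trans (occ-meeting-∈ z∈σ)
        (trans (occ≡1 (∈∧∉⇒≢ z∈σ 0∉σ) λ 2≤occ →
                  z≢d (cycle-doubled-unique cyc z∈σ (∈-lookup j) 2≤occ (ℕ.≤-reflexive (sym occ≡2))))
               (sym (trans (occ-∷-≢ {i = d} σ (z≢d ∘′ sym)) (Unique⇒occ≡1 u z∈σ))))

  meeting-cycle-avoiding-zero : ∀ {σ} → IsCycle π σ → zero ∉ σ → ∀ j → occ f (lookup σ j) ≡ 2 →
    meeting f σ ≡ (drop (toℕ j) σ ++ take (toℕ j) σ) ++ lookup σ j ∷ []
  meeting-cycle-avoiding-zero {σ@(_ ∷ as)} cyc@(u , _) 0∉σ j occ≡2 = begin
    meeting f σ                             ≡⟨ meeting≡ ⟩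
    d ∷ t                                   ≡⟨ cong (d ∷_) t≡bs ⟩
    d ∷ bs                                  ≡⟨ iterate-∷ʳ d ℓ ⟩
    iterate next d ℓ ∷ʳ iter π ℓ d          ≡⟨ cong (iterate next d ℓ ∷ʳ_) (cycle-period cyc j) ⟩
    iterate next d ℓ ∷ʳ d                   ≡⟨ cong (_∷ʳ d) (rotate-cycle cyc j) ⟨
    (drop (toℕ j) σ ++ take (toℕ j) σ) ∷ʳ d ∎
    where
    open ≡-Reasoning
    ℓ  = length σ
    d  = lookup σ j
    bs = iterate next (next d) ℓ
    first = meeting-head-doubled cyc 0∉σ
    t = proj₁ (proj₂ first)
    meeting≡ : meeting f σ ≡ d ∷ t
    meeting≡ = let c , _ , eq , c∈σ , c-doubled = first in
      trans eq (cong (_∷ t)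
        (cycle-doubled-unique cyc c∈σ (∈-lookup j) c-doubled (ℕ.≤-reflexive (sym occ≡2))))
    rot↭σ : iterate next d ℓ ↭ σ
    rot↭σ = subst (_↭ σ) (rotate-cycle cyc j) (drop++take↭ (toℕ j) σ)
    bs↭σ : bs ↭ σ
    bs↭σ = ↭-trans (iterate-next-↭ (cycle-period cyc j)) rot↭σ
    occ-t : ∀ z → occ t z ≡ occ bs z
    occ-t = occ-∷-cancel d λ z → begin
      occ (d ∷ t) z       ≡⟨ cong (λ h → occ h z) meeting≡ ⟨
      occ (meeting f σ) z ≡⟨ occ-meeting-cycle cyc 0∉σ j occ≡2 z ⟩
      occ (d ∷ σ) z       ≡⟨ occ-↭ (↭-prep d (↭-sym bs↭σ)) z ⟩
      occ (d ∷ bs) z      ∎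
    steps : ∀ {x} → x ∈ iterate next (next d) (length as) → x ∷ next x ∷ [] ⊆ t
    steps {x} x∈ = ∷ʳ⁻ x≢d (subst (_ ⊆_) meeting≡
                              (step-⊆ (_∈? σ) x∈σ nx∈σ (∈∧∉⇒≢ x∈σ 0∉σ) (∈∧∉⇒≢ nx∈σ 0∉σ)))
      where
      x∈σ  = ∈-resp-↭ bs↭σ (∈-iterate-suc next (next d) (length as) x∈)
      nx∈σ = ∈-resp-↭ bs↭σ (there (∈-iterate-step next (next d) (length as) x∈))
      x≢d : x ≢ d
      x≢d refl = All¬⇒¬Any (AllPairs.head (Unique-resp-↭ (↭-sym rot↭σ) u)) x∈
    t≡bs : t ≡ bs
    t≡bs = iterate-chain next (length as) (next d) (Unique-resp-↭ (↭-sym bs↭σ) u) occ-t steps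

lemma2p1 : ∀ {n} (π : Permutation′ (suc n)) (f : List (Fin (suc n))) →
    IsMinTransStarFact π f →
    (σ : List (Fin (suc n))) → IsCycle π σ →
    ((¬ (zero ∈ σ)) →
      (∃ λ (j : Fin (length σ)) →
        occ f (lookup σ j) ≡ 2 × (∀ (i : Fin (length σ)) → i ≢ j → occ f (lookup σ i) ≡ 1))
      × (∀ (j : Fin (length σ)) → occ f (lookup σ j) ≡ 2 →
          meeting f σ ≡ (drop (toℕ j) σ ++ take (toℕ j) σ) ++ lookup σ j ∷ []))
    × (∀ (bs : List (Fin (suc n))) → σ ≡ zero ∷ bs →
        All (λ b → occ f b ≡ 1) bs × meeting f σ ≡ bs)
lemma2p1 π f min-fact σ cyc =
  (λ 0∉σ → cycle-one-doubled cyc 0∉σ , meeting-cycle-avoiding-zero cyc 0∉σ) ,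
  meeting-cycle-of-zero cyc
  where open MinimalStarFactorization min-fact
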